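{- Let $p(n)$ denote the number of partitions of the nonnegative integer $n$ (with $p(0)=1$). Assume the log-concavity property $p(n)^2\geq p(n-1)\,p(n+1)$ holds for all $n\geq 26$. Then $p(m)\,p(n) > p(m+n)$ for all integers $m,n\geq 2$ with $m+n>9$.
   Context: A partition of $n$ is a way of writing $n$ as an unordered sum of positive integers. The paper phrases this corollary as: "the log-concavity result by Nicolas implies the Bessenrodt--Ono inequality result by Bessenrodt and Ono"; Nicolas' result gives log-concavity of $p(n)$ for all even $n$ and all odd $n>25$, in particular for all $n\geq 26$. -}

module Defs where

open import Data.Nat using (ℕ; zero; suc; _+_; _∸_; _≤?_)
open import Data.List using (List; []; _∷_; map; length; concatMap; upTo)
open import Relation.Nullary.Decidable using (does)
open import Data.Bool using (if_then_else_)

-- A partition of n is written as a non-increasing list of positive parts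
-- summing to n.  'parts k n' enumerates all partitions of n whose parts
-- are all ≤ k: choose the largest part j ∈ {1,…,min(k,n)}, then
-- recursively a partition of n ∸ j with parts ≤ j.
-- The extra argument 'fuel' (= n) makes the recursion structural.
partsF : ℕ → ℕ → ℕ → List (List ℕ)
partsF fuel       k zero    = [] ∷ []
partsF zero       k (suc n) = []
partsF (suc fuel) k (suc n) =
  concatMap (λ i → let j = suc i in
                   if does (j ≤? k)
                   then map (j ∷_) (partsF fuel j (suc n ∸ j))
                   else [])
            (upTo (suc n))

partitions : ℕ → List (List ℕ)
partitions n = partsF n n n

p : ℕ → ℕ
p n = length (partitions n)

-- Log-concavity from 25 on makes the ratio p(n+1)/p(n) non-increasing for n ≥ 25.
-- So for n ≥ 25, raising n by one multiplies p(m+n) by at most the factor by which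
-- it multiplies p(n), and the strict inequality p(m+n) < p(m)p(n) propagates from
-- n = 25 to all larger n, in either argument by symmetry.  This leaves m, n ≤ 25:
-- for m + n ≤ 25 the inequality is read off the values p(0), …, p(25); for
-- m + n > 25 the same monotonicity bounds p(m+n) by the geometric progression
-- p(25)(p(26)/p(25))^(m+n-25), and what remains is again a finite check.
module Submission where

open import Defs
open import Data.Nat using (ℕ; suc; _+_; _*_; _∸_; _≤_; _<_; _≥_; _>_; _^_; s≤s; z≤n; z<s; NonZero; >-nonZero)
open import Data.Nat.Properties
open import Algebra.Properties.CommutativeSemigroup *-commutativeSemigroup
  using (interchange; xy∙z≈xz∙y; xy∙z≈x∙zy)
open import Data.List using ([]; _∷_; map; length; drop; head)
open import Data.List.Properties using (length-++; length-map)
open import Data.Maybe using (fromMaybe)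
open import Relation.Nullary.Decidable using (from-yes; _→-dec_; yes; no)
open import Relation.Binary.PropositionalEquality using (_≡_; cong; cong₂; subst; subst₂)

LogConcaveAbove : (ℕ → ℕ) → ℕ → Set
LogConcaveAbove f N = ∀ n → n > N → f (n ∸ 1) * f (n + 1) ≤ f n ^ 2

SubmultiplicativeAt : (ℕ → ℕ) → ℕ → ℕ → Set
SubmultiplicativeAt f m n = f (m + n) < f m * f n

submultiplicativeAt-comm : ∀ f m n → SubmultiplicativeAt f m n → SubmultiplicativeAt f n m
submultiplicativeAt-comm f m n = subst₂ _<_ (cong f (+-comm m n)) (*-comm (f m) (f n))

module LogConcaveTail (f : ℕ → ℕ) (f>0 : ∀ n → f n > 0) (N : ℕ) (f-logConcave : LogConcaveAbove f N) where

  open ≤-Reasoning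

  log-concave : ∀ {k} → N ≤ k → f k * f (2 + k) ≤ f (1 + k) * f (1 + k)
  log-concave {k} N≤k = begin
    f k * f (2 + k)            ≡⟨ cong (λ i → f k * f (suc i)) (+-comm 1 k) ⟩
    f k * f (1 + k + 1)        ≤⟨ f-logConcave (1 + k) (s≤s N≤k) ⟩
    f (1 + k) ^ 2              ≡⟨ cong (f (1 + k) *_) (*-identityʳ (f (1 + k))) ⟩
    f (1 + k) * f (1 + k)      ∎

  ratio-antitone : ∀ {n} → N ≤ n → ∀ j → f (suc (j + n)) * f n ≤ f (j + n) * f (suc n)
  ratio-antitone {n} N≤n 0       = ≤-reflexive (*-comm (f (suc n)) (f n))
  ratio-antitone {n} N≤n (suc j) = *-cancelˡ-≤ (a * b) {{ab≢0}} (begin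
      (a * b) * (c * x)  ≡⟨ interchange a b c x ⟩
      (a * c) * (b * x)  ≤⟨ *-mono-≤ (log-concave (≤-trans N≤n (m≤n+m n j))) (ratio-antitone N≤n j) ⟩
      (b * b) * (a * y)  ≡⟨ interchange b b a y ⟩
      (b * a) * (b * y)  ≡⟨ cong (_* (b * y)) (*-comm b a) ⟩
      (a * b) * (b * y)  ∎)
    where
    a = f (j + n)
    b = f (suc (j + n))
    c = f (suc (suc (j + n)))
    x = f n
    y = f (suc n)
    ab≢0 : NonZero (a * b)
    ab≢0 = >-nonZero (*-mono-< (f>0 (j + n)) (f>0 (suc (j + n))))

  geometric-bound : ∀ j → f (j + N) * f N ^ j ≤ f N * f (suc N) ^ j
  geometric-bound 0       = ≤-refl
  geometric-bound (suc j) = begin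
    f (suc (j + N)) * (f N * f N ^ j)    ≡⟨ *-assoc (f (suc (j + N))) (f N) (f N ^ j) ⟨
    f (suc (j + N)) * f N * f N ^ j      ≤⟨ *-monoˡ-≤ (f N ^ j) (ratio-antitone ≤-refl j) ⟩
    f (j + N) * f (suc N) * f N ^ j      ≡⟨ xy∙z≈xz∙y (f (j + N)) (f (suc N)) (f N ^ j) ⟩
    f (j + N) * f N ^ j * f (suc N)      ≤⟨ *-monoˡ-≤ (f (suc N)) (geometric-bound j) ⟩
    f N * f (suc N) ^ j * f (suc N)      ≡⟨ xy∙z≈x∙zy (f N) (f (suc N) ^ j) (f (suc N)) ⟩
    f N * (f (suc N) * f (suc N) ^ j)    ∎

  submultiplicativeAt-suc : ∀ m {n} → N ≤ n → SubmultiplicativeAt f m n → SubmultiplicativeAt f m (suc n)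
  submultiplicativeAt-suc m {n} N≤n fm+n<fmfn rewrite +-suc m n =
    *-cancelʳ-< (f n) (f (suc (m + n))) (f m * f (suc n)) (begin-strict
      f (suc (m + n)) * f n    ≤⟨ ratio-antitone N≤n m ⟩
      f (m + n) * f (suc n)    <⟨ *-monoˡ-< (f (suc n)) {{>-nonZero (f>0 (suc n))}} fm+n<fmfn ⟩
      f m * f n * f (suc n)    ≡⟨ xy∙z≈xz∙y (f m) (f n) (f (suc n)) ⟩
      f m * f (suc n) * f n    ∎)

  submultiplicativeAt-beyond : ∀ m {n} → N ≤ n → SubmultiplicativeAt f m N → SubmultiplicativeAt f m n
  submultiplicativeAt-beyond m {n} N≤n base = subst (SubmultiplicativeAt f m) (m∸n+n≡m N≤n) (go (n ∸ N))
    where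
    go : ∀ j → SubmultiplicativeAt f m (j + N)
    go 0       = base
    go (suc j) = submultiplicativeAt-suc m (m≤n+m N j) (go j)

length-partsF-positive : ∀ fuel k n → n ≤ fuel → length (partsF fuel (suc k) n) > 0
length-partsF-positive fuel       k 0       _             = z<s
length-partsF-positive (suc fuel) k (suc n) (s≤s n≤fuel) = begin-strict
    0                                                <⟨ length-partsF-positive fuel 0 n n≤fuel ⟩
    length (partsF fuel 1 n)                         ≡⟨ length-map (1 ∷_) (partsF fuel 1 n) ⟨
    length (map (1 ∷_) (partsF fuel 1 n))            ≤⟨ m≤m+n _ _ ⟩
    length (map (1 ∷_) (partsF fuel 1 n)) + _        ≡⟨ length-++ (map (1 ∷_) (partsF fuel 1 n)) ⟨
    length (partsF (suc fuel) (suc k) (suc n))       ∎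
  where open ≤-Reasoning

p>0 : ∀ n → p n > 0
p>0 0       = z<s
p>0 (suc n) = length-partsF-positive (suc n) n (suc n) ≤-refl

-- The finite checks below go through pTable because re-enumerating partitions for
-- every pair (m, n) would be prohibitively slow.
pTable : ℕ → ℕ
pTable k = fromMaybe 0 (head (drop k
  (1 ∷ 1 ∷ 2 ∷ 3 ∷ 5 ∷ 7 ∷ 11 ∷ 15 ∷ 22 ∷ 30 ∷ 42 ∷ 56 ∷ 77 ∷ 101 ∷ 135 ∷ 176 ∷ 231 ∷ 297
     ∷ 385 ∷ 490 ∷ 627 ∷ 792 ∷ 1002 ∷ 1255 ∷ 1575 ∷ 1958 ∷ 2436 ∷ [])))

p≡pTable : ∀ {k} → k < 27 → p k ≡ pTable k
p≡pTable = from-yes (allUpTo? (λ k → p k ≟ pTable k) 27)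

pTable-submultiplicative : ∀ {m} → m < 26 → ∀ {n} → n < 26 → 2 ≤ m → 2 ≤ n → 9 < m + n → m + n < 26
                         → pTable (m + n) < pTable m * pTable n
pTable-submultiplicative = from-yes (allUpTo? (λ m → allUpTo? (λ n →
  2 ≤? m →-dec 2 ≤? n →-dec 9 <? m + n →-dec m + n <? 26 →-dec pTable (m + n) <? pTable m * pTable n) 26) 26)

pTable-geometric-submultiplicative : ∀ {m} → m < 26 → ∀ {n} → n < 26 → 2 ≤ m → 2 ≤ n → 25 < m + n
  → pTable 25 * pTable 26 ^ (m + n ∸ 25) < pTable m * pTable n * pTable 25 ^ (m + n ∸ 25)
pTable-geometric-submultiplicative = from-yes (allUpTo? (λ m → allUpTo? (λ n →
  2 ≤? m →-dec 2 ≤? n →-dec 25 <? m + n →-dec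
  pTable 25 * pTable 26 ^ (m + n ∸ 25) <? pTable m * pTable n * pTable 25 ^ (m + n ∸ 25)) 26) 26)

p*p≡pTable*pTable : ∀ {m n} → m < 26 → n < 26 → p m * p n ≡ pTable m * pTable n
p*p≡pTable*pTable {m} {n} m<26 n<26 = cong₂ _*_ (p≡pTable {m} (m<n⇒m<1+n m<26)) (p≡pTable {n} (m<n⇒m<1+n n<26))

p-submultiplicativeAt-tabulated : ∀ {m n} → m < 26 → n < 26 → 2 ≤ m → 2 ≤ n → 9 < m + n → m + n < 26
                              → SubmultiplicativeAt p m n
p-submultiplicativeAt-tabulated {m} {n} m<26 n<26 2≤m 2≤n 9<m+n m+n<26 = begin-strict
  p (m + n)             ≡⟨ p≡pTable {m + n} (m<n⇒m<1+n m+n<26) ⟩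
  pTable (m + n)        <⟨ pTable-submultiplicative {m} m<26 {n} n<26 2≤m 2≤n 9<m+n m+n<26 ⟩
  pTable m * pTable n   ≡⟨ p*p≡pTable*pTable m<26 n<26 ⟨
  p m * p n             ∎
  where open ≤-Reasoning

p-submultiplicativeAt-geometric : LogConcaveAbove p 25 → ∀ {m n} → m < 26 → n < 26 → 2 ≤ m → 2 ≤ n → 25 < m + n
                              → SubmultiplicativeAt p m n
p-submultiplicativeAt-geometric lc {m} {n} m<26 n<26 2≤m 2≤n 25<m+n =
  *-cancelʳ-< (pTable 25 ^ j) (p (m + n)) (p m * p n) (begin-strict
    p (m + n) * pTable 25 ^ j              ≡⟨ cong₂ (λ k t → p k * t ^ j) (m∸n+n≡m (<⇒≤ 25<m+n)) p25≡ ⟨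
    p (j + 25) * p 25 ^ j                  ≤⟨ geometric-bound j ⟩
    p 25 * p (suc 25) ^ j                  ≡⟨ cong₂ (λ s t → s * t ^ j) p25≡ p26≡ ⟩
    pTable 25 * pTable 26 ^ j              <⟨ pTable-geometric-submultiplicative {m} m<26 {n} n<26 2≤m 2≤n 25<m+n ⟩
    pTable m * pTable n * pTable 25 ^ j    ≡⟨ cong (_* pTable 25 ^ j) (p*p≡pTable*pTable m<26 n<26) ⟨
    p m * p n * pTable 25 ^ j              ∎)
  where
  open LogConcaveTail p p>0 25 lc
  open ≤-Reasoning
  j = m + n ∸ 25
  p25≡ : p 25 ≡ pTable 25
  p25≡ = p≡pTable {25} (m<n⇒m<1+n (n<1+n 25))
  -- Written suc 25, as in geometric-bound: unifying p (suc 25) with p 26 would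
  -- make the type checker enumerate the partitions of 26.
  p26≡ : p (suc 25) ≡ pTable 26
  p26≡ = p≡pTable {suc 25} (n<1+n 26)

p-submultiplicativeAt-small : LogConcaveAbove p 25 → ∀ {m n} → m < 26 → n < 26 → 2 ≤ m → 2 ≤ n → 9 < m + n
                            → SubmultiplicativeAt p m n
p-submultiplicativeAt-small lc {m} {n} m<26 n<26 2≤m 2≤n 9<m+n with m + n <? 26
... | yes m+n<26 = p-submultiplicativeAt-tabulated m<26 n<26 2≤m 2≤n 9<m+n m+n<26
... | no  m+n≮26 = p-submultiplicativeAt-geometric lc m<26 n<26 2≤m 2≤n (≮⇒≥ m+n≮26)

p-submultiplicativeAt-leftSmall : LogConcaveAbove p 25 → ∀ {m n} → m < 26 → 2 ≤ m → 2 ≤ n → 9 < m + n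
                                → SubmultiplicativeAt p m n
p-submultiplicativeAt-leftSmall lc {m} {n} m<26 2≤m 2≤n 9<m+n with n <? 26
... | yes n<26 = p-submultiplicativeAt-small lc m<26 n<26 2≤m 2≤n 9<m+n
... | no  n≮26 = submultiplicativeAt-beyond m (<⇒≤ (≮⇒≥ n≮26))
                   (p-submultiplicativeAt-geometric lc m<26 (n<1+n 25) 2≤m (s≤s (s≤s z≤n)) (+-monoˡ-≤ 25 (<⇒≤ 2≤m)))
  where open LogConcaveTail p p>0 25 lc

corollary1p2 : (∀ n → n ≥ 26 → p (n ∸ 1) * p (n + 1) ≤ p n ^ 2)
             → ∀ m n → m ≥ 2 → n ≥ 2 → m + n > 9 → p m * p n > p (m + n)
corollary1p2 lc m n 2≤m 2≤n 9<m+n with m <? 26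
... | yes m<26 = p-submultiplicativeAt-leftSmall lc m<26 2≤m 2≤n 9<m+n
... | no  m≮26 = submultiplicativeAt-comm p n m (submultiplicativeAt-beyond n (<⇒≤ (≮⇒≥ m≮26)) p[n+25]<p[n]p[25])
  where
  open LogConcaveTail p p>0 25 lc
  p[n+25]<p[n]p[25] : SubmultiplicativeAt p n 25
  p[n+25]<p[n]p[25] = submultiplicativeAt-comm p 25 n
    (p-submultiplicativeAt-leftSmall lc (n<1+n 25) (s≤s (s≤s z≤n)) 2≤n (≤-trans (m≤m+n 10 15) (m≤m+n 25 n)))
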